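{- Let $G=(V,E)$ be a locally finite Borel graph and let $\phi_V,\phi_E$ be as defined in the context. (1) If $x,y\in V$ with $x$ adjacent to $y$, then $\phi_V(x)=\phi_V(y)$ if and only if there is an automorphism of $G$ taking $x$ to $y$. (2) If $f,h\in E$ lie in the same connected component of $G$, then $\phi_E(f)=\phi_E(h)$ if and only if there is an automorphism of $G$ taking $f$ to $h$.
   Context: For a graph and vertex $x$, $B_n(x)$ is the set of vertices at distance $\le n$ from $x$; for an edge $h=\{x,y\}$, $B_n(h)=B_n(x)\cup B_n(y)$; $G\upharpoonright S$ is the induced subgraph on $S$. $\phi_V(x)$ is the sequence $((G\upharpoonright B_n(x),x))_{n\in\mathbb{N}}$ of isomorphism classes of finite rooted graphs, and $\phi_E(h)$ is the sequence $((G\upharpoonright B_n(h),h))_{n\in\mathbb{N}}$ of isomorphism classes of finite graphs with a distinguished edge. Automorphisms of $G$ are graph automorphisms (not required to be Borel). -}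

module Defs where

open import Data.Nat using (ℕ; zero; suc)
open import Data.List using (List)
open import Data.List.Membership.Propositional using (_∈_)
open import Data.Product using (Σ; _×_; ∃)
open import Data.Sum using (_⊎_)
open import Data.Unit using (⊤)
open import Relation.Nullary using (¬_)
open import Relation.Binary.PropositionalEquality using (_≡_)
open import Function.Bundles using (_⇔_)

record Graph : Set₁ where
  field
    V      : Set
    _~_    : V → V → Set
    ~-sym  : ∀ {x y} → x ~ y → y ~ x
    ~-irr  : ∀ {x} → ¬ (x ~ x)

module _ (G : Graph) where
  open Graph G

  LocallyFinite : Set
  LocallyFinite = ∀ x → Σ (List V) λ ns → ∀ y → (x ~ y → y ∈ ns) × (y ∈ ns → x ~ y)

  -- Walk of length ≤ n from x to y, i.e. dist(x,y) ≤ n.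
  data Walk≤ : ℕ → V → V → Set where
    here : ∀ {n x} → Walk≤ n x x
    step : ∀ {n x y z} → x ~ y → Walk≤ n y z → Walk≤ (suc n) x z

  Ball : ℕ → V → V → Set
  Ball n x v = Walk≤ n x v

  BallE : ℕ → V → V → V → Set
  BallE n a b v = Ball n a v ⊎ Ball n b v

  Connected : V → V → Set
  Connected x y = ∃ λ n → Walk≤ n x y

  -- An isomorphism between the induced subgraphs G↾P and G↾Q
  -- (given by maps V → V whose values outside P resp. Q are irrelevant).
  record InducedIso (P Q : V → Set) : Set where
    field
      fwd   : V → V
      bwd   : V → V
      fwd∈  : ∀ v → P v → Q (fwd v)
      bwd∈  : ∀ v → Q v → P (bwd v)
      bwd∘fwd : ∀ v → P v → bwd (fwd v) ≡ v
      fwd∘bwd : ∀ v → Q v → fwd (bwd v) ≡ v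
      adj   : ∀ u v → P u → P v → (u ~ v) ⇔ (fwd u ~ fwd v)

  MapsEdge : (V → V) → V → V → V → V → Set
  MapsEdge σ a b c d = (σ a ≡ c × σ b ≡ d) ⊎ (σ a ≡ d × σ b ≡ c)

  -- φ_V(x) = φ_V(y): for every n, (G↾B_n(x), x) ≅ (G↾B_n(y), y) as rooted graphs.
  φV-≡ : V → V → Set
  φV-≡ x y = ∀ n → Σ (InducedIso (Ball n x) (Ball n y)) λ i → InducedIso.fwd i x ≡ y

  -- φ_E({a,b}) = φ_E({c,d}): for every n, (G↾B_n({a,b}), {a,b}) ≅ (G↾B_n({c,d}), {c,d}).
  φE-≡ : V → V → V → V → Set
  φE-≡ a b c d = ∀ n → Σ (InducedIso (BallE n a b) (BallE n c d)) λ i →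
                   MapsEdge (InducedIso.fwd i) a b c d

  -- A graph automorphism of G (not required to be Borel).
  record Automorphism : Set where
    field
      σ     : V → V
      σ⁻¹   : V → V
      σ⁻¹∘σ : ∀ v → σ⁻¹ (σ v) ≡ v
      σ∘σ⁻¹ : ∀ v → σ (σ⁻¹ v) ≡ v
      adj   : ∀ u v → (u ~ v) ⇔ (σ u ~ σ v)

{-# OPTIONS --safe #-}
-- An automorphism carrying one edge to the other restricts to isomorphisms of all the balls around them.
-- Conversely, in a locally finite graph balls are finite, so the restriction to B_k of an isomorphism of
-- larger balls is one of finitely many maps. By König's lemma (an infinite pigeonhole argument, using
-- excluded middle) we can therefore choose isomorphisms i_k of the k-balls such that i_{k+1} extends i_k
-- and each i_k is a restriction of isomorphisms of arbitrarily large balls. Their union is an isomorphism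
-- of the component containing both edges onto itself, since every vertex of it lies in some ball; extended
-- by the identity elsewhere it is the required automorphism. A vertex x is the degenerate edge {x, x},
-- so part (1) is a special case.
module Submission where

open import Level using (0ℓ)
open import Axiom.ExcludedMiddle using (ExcludedMiddle)
open import Axiom.DoubleNegationElimination using (em⇒dne)
open import Data.Empty using (⊥-elim)
open import Data.List using (List; []; _∷_; _++_; map; length; concatMap; cartesianProductWith)
open import Data.List.Properties using (∷-injective)
open import Data.List.Membership.Propositional using (_∈_; lose; find)
open import Data.List.Membership.Propositional.Properties
  using (∈-++⁺ˡ; ∈-++⁺ʳ; ∈-++⁻; ∈-concatMap⁺; ∈-concatMap⁻; ∈-cartesianProductWith⁺)
open import Data.List.Relation.Unary.Any using (Any; here; there; satisfied)
import Data.List.Relation.Unary.Any as Any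
open import Data.Nat using (ℕ; zero; suc; _+_; _≤_; s≤s)
open import Data.Nat.Properties using (+-comm; +-suc; ≤-trans; m≤m+n; m≤n+m; n≤1+n; +-monoˡ-≤)
open import Data.Product using (Σ; _×_; _,_; proj₁; proj₂; ∃-syntax)
open import Data.Sum using (inj₁; inj₂; [_,_]′)
open import Data.Unit using (⊤; tt)
open import Function using (_∘_; id)
open import Function.Bundles using (_⇔_; mk⇔; Equivalence)
import Function.Properties.Equivalence as ⇔
open import Relation.Binary.PropositionalEquality
  using (_≡_; refl; sym; trans; cong; subst; subst₂; module ≡-Reasoning)
open import Relation.Nullary using (¬_; yes; no)
open import Relation.Nullary.Decidable using (toSum)
open import Relation.Unary using (Pred; _≐_)
open import Relation.Unary.Properties using (≐-sym)
open import Defs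

open Equivalence using (to; from)

module _ (lem : ExcludedMiddle 0ℓ) {A : Set} where

  ¬∀⇒∃¬ : {P : ℕ → Set} → ¬ (∀ m → P m) → ∃[ m ] ¬ P m
  ¬∀⇒∃¬ ¬∀ = em⇒dne lem λ ¬∃ → ¬∀ λ m → em⇒dne lem λ ¬p → ¬∃ (m , ¬p)

  pigeonhole : {R : ℕ → Pred A 0ℓ} →
               (∀ {m m' x} → m ≤ m' → R m' x → R m x) →
               (xs : List A) → (∀ m → Any (R m) xs) → Any (λ x → ∀ m → R m x) xs
  pigeonhole anti [] hit with hit 0
  ... | ()
  pigeonhole {R} anti (x ∷ xs) hit with lem {∀ m → R m x}
  ... | yes always = here always
  ... | no ¬always =
    there (Any.map (λ r m → anti (m≤m+n m m₀) (r m)) (pigeonhole (anti ∘ +-monoˡ-≤ m₀) xs hitLater))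
    where
      m₀ = proj₁ (¬∀⇒∃¬ ¬always)
      hitLater : ∀ m → Any (R (m + m₀)) xs
      hitLater m with hit (m + m₀)
      ... | here r = ⊥-elim (proj₂ (¬∀⇒∃¬ ¬always) (anti (m≤n+m m₀ m) r))
      ... | there rs = rs

module _ {A : Set} where

  words : ℕ → List A → List (List A)
  words zero M = [] ∷ []
  words (suc n) M = cartesianProductWith _∷_ M (words n M)

  map-∈-words : ∀ {B : Set} {h : B → A} {M} (L : List B) → (∀ {v} → v ∈ L → h v ∈ M) →
                map h L ∈ words (length L) M
  map-∈-words [] _ = here refl
  map-∈-words (l ∷ L) into = ∈-cartesianProductWith⁺ _∷_ (into (here refl)) (map-∈-words L (into ∘ there))

  map-≡⇒≡ : ∀ {B : Set} {h h' : B → A} {L v} → map h L ≡ map h' L → v ∈ L → h v ≡ h' v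
  map-≡⇒≡ {L = _ ∷ _} e (here refl) = proj₁ (∷-injective e)
  map-≡⇒≡ {L = _ ∷ _} e (there v∈) = map-≡⇒≡ (proj₂ (∷-injective e)) v∈

module _ (G : Graph) where
  open Graph G

  private variable
    a b c d u v x y : V
    j k m n : ℕ

  weaken : j ≤ m → Walk≤ G j x y → Walk≤ G m x y
  weaken _ here = here
  weaken (s≤s le) (step e w) = step e (weaken le w)

  snoc : Walk≤ G n x u → u ~ v → Walk≤ G (suc n) x v
  snoc here e = step e here
  snoc (step e' w) e = step e' (snoc w e)

  reverse : Walk≤ G n x y → Walk≤ G n y x
  reverse here = here
  reverse (step e w) = snoc (reverse w) (~-sym e)

  _++ʷ_ : Walk≤ G m x y → Walk≤ G n y u → Walk≤ G (m + n) x u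
  _++ʷ_ {m} {n = n} here w' = weaken (m≤n+m n m) w'
  step e w ++ʷ w' = step e (w ++ʷ w')

  Connected-refl : Connected G x x
  Connected-refl = 0 , here

  ~⇒Connected : x ~ y → Connected G x y
  ~⇒Connected e = 1 , step e here

  Connected-sym : Connected G x y → Connected G y x
  Connected-sym (n , w) = n , reverse w

  Connected-trans : Connected G x y → Connected G y u → Connected G x u
  Connected-trans (m , w) (n , w') = m + n , w ++ʷ w'

  BallE-mono : j ≤ m → BallE G j a b v → BallE G m a b v
  BallE-mono le = [ inj₁ ∘ weaken le , inj₂ ∘ weaken le ]′

  BallE-step : BallE G n a b u → u ~ v → BallE G (suc n) a b v
  BallE-step (inj₁ w) e = inj₁ (snoc w e)
  BallE-step (inj₂ w) e = inj₂ (snoc w e)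

  InSomeBall : V → V → V → Set
  InSomeBall a b v = ∃[ n ] BallE G n a b v

  InSomeBall-recentre : Connected G c a → Connected G c b → InSomeBall a b v → InSomeBall c d v
  InSomeBall-recentre (m , ca) _ (n , inj₁ w) = m + n , inj₁ (ca ++ʷ w)
  InSomeBall-recentre _ (m , cb) (n , inj₂ w) = m + n , inj₁ (cb ++ʷ w)

  AgreeOn : Pred V 0ℓ → (V → V) → (V → V) → Set
  AgreeOn P h h' = ∀ v → P v → h v ≡ h' v

  adj-inverse : ∀ {f g : V → V} → f (g u) ≡ u → f (g v) ≡ v →
                (g u ~ g v) ⇔ (f (g u) ~ f (g v)) → (u ~ v) ⇔ (g u ~ g v)
  adj-inverse {u} {v} {g = g} fgu fgv adj = ⇔.sym (subst₂ (λ x y → (g u ~ g v) ⇔ (x ~ y)) fgu fgv adj)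

  InducedIso-sym : ∀ {P Q} → InducedIso G P Q → InducedIso G Q P
  InducedIso-sym i = record
    { fwd = bwd ; bwd = fwd ; fwd∈ = bwd∈ ; bwd∈ = fwd∈ ; bwd∘fwd = fwd∘bwd ; fwd∘bwd = bwd∘fwd
    ; adj = λ u v qu qv → adj-inverse {f = fwd} (fwd∘bwd u qu) (fwd∘bwd v qv) (adj _ _ (bwd∈ u qu) (bwd∈ v qv)) }
    where open InducedIso i

  InducedIso-cong : ∀ {P P' Q Q'} → P ≐ P' → Q ≐ Q' → InducedIso G P Q → InducedIso G P' Q'
  InducedIso-cong (P⊆P' , P'⊆P) (Q⊆Q' , Q'⊆Q) i = record
    { fwd = fwd ; bwd = bwd
    ; fwd∈ = λ v p → Q⊆Q' (fwd∈ v (P'⊆P p))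
    ; bwd∈ = λ v q → P⊆P' (bwd∈ v (Q'⊆Q q))
    ; bwd∘fwd = λ v p → bwd∘fwd v (P'⊆P p)
    ; fwd∘bwd = λ v q → fwd∘bwd v (Q'⊆Q q)
    ; adj = λ u v pu pv → adj u v (P'⊆P pu) (P'⊆P pv) }
    where open InducedIso i

  -- Adjacency is only preserved inside B_m(a,b); a walk of length k from B_j(a,b) stays there as j + k ≤ m.
  InducedIso-walk : ∀ {Q} (i : InducedIso G (BallE G m a b) Q) → j + k ≤ m → BallE G j a b u →
                    Walk≤ G k u v → Walk≤ G k (InducedIso.fwd i u) (InducedIso.fwd i v)
  InducedIso-walk i le p here = here
  InducedIso-walk {m = m} {j = j} {k = suc k} i le p (step e w) =
    step (to (InducedIso.adj i _ _ (BallE-mono (≤-trans (m≤m+n j (suc k)) le) p)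
                                   (BallE-mono (≤-trans (m≤m+n (suc j) k) le') (BallE-step p e))) e)
         (InducedIso-walk i le' (BallE-step p e) w)
    where
      le' : suc j + k ≤ m
      le' = subst (_≤ m) (+-suc j k) le

  MapsEdge-inverse : ∀ {f g : V → V} → g (f a) ≡ a → g (f b) ≡ b →
                     MapsEdge G f a b c d → MapsEdge G g c d a b
  MapsEdge-inverse {g = g} gfa gfb (inj₁ (fa , fb)) =
    inj₁ (trans (cong g (sym fa)) gfa , trans (cong g (sym fb)) gfb)
  MapsEdge-inverse {g = g} gfa gfb (inj₂ (fa , fb)) =
    inj₂ (trans (cong g (sym fb)) gfb , trans (cong g (sym fa)) gfa)

  MapsEdge-cong : ∀ {f g : V → V} → f a ≡ g a → f b ≡ g b → MapsEdge G g a b c d → MapsEdge G f a b c d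
  MapsEdge-cong fa fb (inj₁ (ga , gb)) = inj₁ (trans fa ga , trans fb gb)
  MapsEdge-cong fa fb (inj₂ (ga , gb)) = inj₂ (trans fa ga , trans fb gb)

  MapsEdge-diagonal : (f : V → V) → MapsEdge G f x x y y ⇔ (f x ≡ y)
  MapsEdge-diagonal f = mk⇔ [ proj₁ , proj₁ ]′ (λ e → inj₁ (e , e))

  MapsEdge-BallE : ∀ {f : V → V} → MapsEdge G f a b c d →
                   (∀ {v} → Walk≤ G k a v → Walk≤ G k (f a) (f v)) →
                   (∀ {v} → Walk≤ G k b v → Walk≤ G k (f b) (f v)) →
                   BallE G k a b v → BallE G k c d (f v)
  MapsEdge-BallE {k = k} {v = v} {f} me fromA fromB p with me | p
  ... | inj₁ (fa , _) | inj₁ w = inj₁ (subst (λ r → Walk≤ G k r (f v)) fa (fromA w))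
  ... | inj₂ (fa , _) | inj₁ w = inj₂ (subst (λ r → Walk≤ G k r (f v)) fa (fromA w))
  ... | inj₁ (_ , fb) | inj₂ w = inj₂ (subst (λ r → Walk≤ G k r (f v)) fb (fromB w))
  ... | inj₂ (_ , fb) | inj₂ w = inj₁ (subst (λ r → Walk≤ G k r (f v)) fb (fromB w))

  BallIso : ℕ → V → V → V → V → Set
  BallIso n a b c d = Σ (InducedIso G (BallE G n a b) (BallE G n c d)) λ i → MapsEdge G (InducedIso.fwd i) a b c d

  apply : BallIso n a b c d → V → V
  apply = InducedIso.fwd ∘ proj₁

  BallIso-sym : BallIso n a b c d → BallIso n c d a b
  BallIso-sym (i , me) =
    InducedIso-sym i , MapsEdge-inverse {f = fwd} {g = bwd} (bwd∘fwd _ (inj₁ here)) (bwd∘fwd _ (inj₂ here)) me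
    where open InducedIso i

  restrict-BallE : k ≤ m → (i : BallIso m a b c d) → BallE G k a b v → BallE G k c d (apply i v)
  restrict-BallE le (i , me) = MapsEdge-BallE me (InducedIso-walk i le (inj₁ here)) (InducedIso-walk i le (inj₂ here))

  restrict : k ≤ m → BallIso m a b c d → BallIso k a b c d
  restrict le i = record
    { fwd = fwd ; bwd = bwd
    ; fwd∈ = λ v → restrict-BallE le i
    ; bwd∈ = λ v → restrict-BallE le (BallIso-sym i)
    ; bwd∘fwd = λ v p → bwd∘fwd v (BallE-mono le p)
    ; fwd∘bwd = λ v q → fwd∘bwd v (BallE-mono le q)
    ; adj = λ u v pu pv → adj u v (BallE-mono le pu) (BallE-mono le pv) } , proj₂ i
    where open InducedIso (proj₁ i)

  Automorphism-sym : Automorphism G → Automorphism G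
  Automorphism-sym α = record
    { σ = σ⁻¹ ; σ⁻¹ = σ ; σ⁻¹∘σ = σ∘σ⁻¹ ; σ∘σ⁻¹ = σ⁻¹∘σ
    ; adj = λ u v → adj-inverse {f = σ} (σ∘σ⁻¹ u) (σ∘σ⁻¹ v) (adj (σ⁻¹ u) (σ⁻¹ v)) }
    where open Automorphism α

  Automorphism-walk : (α : Automorphism G) →
                      Walk≤ G n x y → Walk≤ G n (Automorphism.σ α x) (Automorphism.σ α y)
  Automorphism-walk α here = here
  Automorphism-walk α (step e w) = step (to (Automorphism.adj α _ _) e) (Automorphism-walk α w)

  Automorphism⇒φE-≡ : Σ (Automorphism G) (λ α → MapsEdge G (Automorphism.σ α) a b c d) → φE-≡ G a b c d
  Automorphism⇒φE-≡ (α , me) n = record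
    { fwd = σ ; bwd = σ⁻¹
    ; fwd∈ = λ v → MapsEdge-BallE me (Automorphism-walk α) (Automorphism-walk α)
    ; bwd∈ = λ v → MapsEdge-BallE (MapsEdge-inverse {f = σ} (σ⁻¹∘σ _) (σ⁻¹∘σ _) me)
                                  (Automorphism-walk (Automorphism-sym α)) (Automorphism-walk (Automorphism-sym α))
    ; bwd∘fwd = λ v _ → σ⁻¹∘σ v
    ; fwd∘bwd = λ v _ → σ∘σ⁻¹ v
    ; adj = λ u v _ _ → adj u v } , me
    where open Automorphism α

  Ball≐BallE : Ball G n x ≐ BallE G n x x
  Ball≐BallE = inj₁ , [ id , id ]′

  φV-≡⇔φE-≡ : φV-≡ G x y ⇔ φE-≡ G x x y y
  φV-≡⇔φE-≡ = mk⇔ vertex⇒edge edge⇒vertex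
    where
      vertex⇒edge : φV-≡ G x y → φE-≡ G x x y y
      vertex⇒edge φ n with φ n
      ... | i , ix = InducedIso-cong Ball≐BallE Ball≐BallE i , from (MapsEdge-diagonal (InducedIso.fwd i)) ix
      edge⇒vertex : φE-≡ G x x y y → φV-≡ G x y
      edge⇒vertex φ n with φ n
      ... | i , me = InducedIso-cong (≐-sym Ball≐BallE) (≐-sym Ball≐BallE) i ,
                     to (MapsEdge-diagonal (InducedIso.fwd i)) me

  module BallLists (lf : LocallyFinite G) where

    neighbours : V → List V
    neighbours x = proj₁ (lf x)

    ~⇒∈-neighbours : x ~ y → y ∈ neighbours x
    ~⇒∈-neighbours {x} {y} = proj₁ (proj₂ (lf x) y)

    ∈-neighbours⇒~ : y ∈ neighbours x → x ~ y
    ∈-neighbours⇒~ {y} {x} = proj₂ (proj₂ (lf x) y)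

    ballList : ℕ → V → List V
    ballList zero x = x ∷ []
    ballList (suc n) x = x ∷ concatMap (ballList n) (neighbours x)

    ∈-ballList⁺ : Walk≤ G n x v → v ∈ ballList n x
    ∈-ballList⁺ {zero} here = here refl
    ∈-ballList⁺ {suc n} here = here refl
    ∈-ballList⁺ (step e w) = there (∈-concatMap⁺ (ballList _) (lose (~⇒∈-neighbours e) (∈-ballList⁺ w)))

    ∈-ballList⁻ : v ∈ ballList n x → Walk≤ G n x v
    ∈-ballList⁻ {n = zero} (here refl) = here
    ∈-ballList⁻ {n = suc n} (here refl) = here
    ∈-ballList⁻ {n = suc n} (there p) with find (∈-concatMap⁻ (ballList n) p)
    ... | _ , y∈ , v∈ = step (∈-neighbours⇒~ y∈) (∈-ballList⁻ v∈)

    ballEList : ℕ → V → V → List V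
    ballEList n a b = ballList n a ++ ballList n b

    ∈-ballEList⁺ : BallE G n a b v → v ∈ ballEList n a b
    ∈-ballEList⁺ (inj₁ w) = ∈-++⁺ˡ (∈-ballList⁺ w)
    ∈-ballEList⁺ {a = a} (inj₂ w) = ∈-++⁺ʳ (ballList _ a) (∈-ballList⁺ w)

    ∈-ballEList⁻ : v ∈ ballEList n a b → BallE G n a b v
    ∈-ballEList⁻ {a = a} p = [ inj₁ ∘ ∈-ballList⁻ , inj₂ ∘ ∈-ballList⁻ ]′ (∈-++⁻ (ballList _ a) p)

  record Coherent (a b c d : V) : Set where
    field
      level    : ∀ n → BallIso n a b c d
      coherent : ∀ n → AgreeOn (BallE G n a b) (apply (level n)) (apply (level (suc n)))

    fun : ℕ → V → V
    fun n = apply (level n)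

  Coherent-sym : Coherent a b c d → Coherent c d a b
  Coherent-sym {a} {b} {c} {d} C = record { level = BallIso-sym ∘ level ; coherent = coherent-bwd }
    where
      open Coherent C
      module L n = InducedIso (proj₁ (level n))
      coherent-bwd : ∀ n → AgreeOn (BallE G n c d) (L.bwd n) (L.bwd (suc n))
      coherent-bwd n v q = begin
        L.bwd n v                         ≡⟨ L.bwd∘fwd (suc n) v₀ (BallE-mono (n≤1+n n) p₀) ⟨
        L.bwd (suc n) (L.fwd (suc n) v₀)  ≡⟨ cong (L.bwd (suc n)) (coherent n v₀ p₀) ⟨
        L.bwd (suc n) (L.fwd n v₀)        ≡⟨ cong (L.bwd (suc n)) (L.fwd∘bwd n v q) ⟩
        L.bwd (suc n) v                   ∎
        where
          open ≡-Reasoning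
          v₀ : V
          v₀ = L.bwd n v
          p₀ : BallE G n a b v₀
          p₀ = L.bwd∈ n v q

  module _ (lem : ExcludedMiddle 0ℓ) where

    glue : V → V → (ℕ → V → V) → V → V
    glue a b f v with lem {InSomeBall a b v}
    ... | yes (n , _) = f n v
    ... | no _ = v

    glue-off : ∀ {f} → ¬ InSomeBall a b v → glue a b f v ≡ v
    glue-off {a} {b} {v} ¬p with lem {InSomeBall a b v}
    ... | yes p = ⊥-elim (¬p p)
    ... | no _ = refl

    module _ (C : Coherent a b c d) where
      open Coherent C

      fun-stable : ∀ j → BallE G k a b v → fun k v ≡ fun (j + k) v
      fun-stable zero p = refl
      fun-stable {k} (suc j) p = trans (fun-stable j p) (coherent (j + k) _ (BallE-mono (m≤n+m k j) p))

      fun-unique : BallE G k a b v → BallE G m a b v → fun k v ≡ fun m v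
      fun-unique {k} {v} {m} p q = begin
        fun k v        ≡⟨ fun-stable m p ⟩
        fun (m + k) v  ≡⟨ cong (λ n → fun n v) (+-comm m k) ⟩
        fun (k + m) v  ≡⟨ fun-stable k q ⟨
        fun m v        ∎
        where open ≡-Reasoning

      glue-on : BallE G n a b v → glue a b fun v ≡ fun n v
      glue-on {v = v} p with lem {InSomeBall a b v}
      ... | yes (_ , q) = fun-unique q p
      ... | no ¬q = ⊥-elim (¬q (_ , p))

      glue-adj : u ~ v → glue a b fun u ~ glue a b fun v
      glue-adj {u} {v} e = [ inBalls , offBalls ]′ (toSum (lem {InSomeBall a b u}))
        where
          inBalls : InSomeBall a b u → glue a b fun u ~ glue a b fun v
          inBalls (n , p) = subst₂ _~_ (sym (glue-on pu)) (sym (glue-on pv))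
                                   (to (InducedIso.adj (proj₁ (level (suc n))) u v pu pv) e)
            where
              pu = BallE-mono (n≤1+n n) p
              pv = BallE-step p e
          offBalls : ¬ InSomeBall a b u → glue a b fun u ~ glue a b fun v
          offBalls ¬p = subst₂ _~_ (sym (glue-off ¬p)) (sym (glue-off ¬pv)) e
            where
              ¬pv : ¬ InSomeBall a b v
              ¬pv (m , q) = ¬p (suc m , BallE-step q (~-sym e))

    glue-leftInverse : Connected G a c → Connected G a d → (C : Coherent a b c d) →
                       ∀ v → glue c d (Coherent.fun (Coherent-sym C)) (glue a b (Coherent.fun C) v) ≡ v
    glue-leftInverse {a} {c} {d} {b} ac ad C v = [ inBalls , offBalls ]′ (toSum (lem {InSomeBall a b v}))
      where
        σ τ : V → V
        σ = glue a b (Coherent.fun C)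
        τ = glue c d (Coherent.fun (Coherent-sym C))
        inBalls : InSomeBall a b v → τ (σ v) ≡ v
        inBalls (n , p) = begin
          τ (σ v)          ≡⟨ cong τ (glue-on C p) ⟩
          τ (L.fwd v)      ≡⟨ glue-on (Coherent-sym C) (L.fwd∈ v p) ⟩
          L.bwd (L.fwd v)  ≡⟨ L.bwd∘fwd v p ⟩
          v                ∎
          where
            open ≡-Reasoning
            module L = InducedIso (proj₁ (Coherent.level C n))
        offBalls : ¬ InSomeBall a b v → τ (σ v) ≡ v
        offBalls ¬p = trans (cong τ (glue-off ¬p)) (glue-off (¬p ∘ InSomeBall-recentre ac ad))

    Coherent⇒Automorphism : Connected G a b → Connected G b c → Connected G c d → Coherent a b c d →
                            Σ (Automorphism G) λ α → MapsEdge G (Automorphism.σ α) a b c d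
    Coherent⇒Automorphism {a} {b} {c} {d} ab bc cd C =
      α , MapsEdge-cong {f = σ} {g = Coherent.fun C 0} (glue-on C (inj₁ here)) (glue-on C (inj₂ here))
                        (proj₂ (Coherent.level C 0))
      where
        σ : V → V
        σ = glue a b (Coherent.fun C)
        C⁻¹ : Coherent c d a b
        C⁻¹ = Coherent-sym C
        ac : Connected G a c
        ac = Connected-trans ab bc
        τ∘σ : ∀ v → glue c d (Coherent.fun C⁻¹) (σ v) ≡ v
        τ∘σ = glue-leftInverse ac (Connected-trans ac cd) C
        σ∘τ : ∀ v → σ (glue c d (Coherent.fun C⁻¹) v) ≡ v
        σ∘τ = glue-leftInverse (Connected-sym ac) (Connected-sym bc) C⁻¹
        α : Automorphism G
        α = record
          { σ = σ ; σ⁻¹ = glue c d (Coherent.fun C⁻¹) ; σ⁻¹∘σ = τ∘σ ; σ∘σ⁻¹ = σ∘τ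
          ; adj = λ u v → mk⇔ (glue-adj C) (λ e → subst₂ _~_ (τ∘σ u) (τ∘σ v) (glue-adj C⁻¹ e)) }

    module _ (lf : LocallyFinite G) {a b c d : V} where
      open BallLists lf

      Extendable : ℕ → (V → V) → Set
      Extendable k h = ∀ m → Σ (BallIso m a b c d) λ j → AgreeOn (BallE G k a b) h (apply j)

      -- König's lemma: a ball isomorphism restricts to B_k(a,b) in one of finitely many ways (a word over
      -- the finite ball B_k(c,d)), so one of these restrictions recurs at all levels.
      select : (k : ℕ) (S : (V → V) → Set) → (∀ m → Σ (BallIso m a b c d) (S ∘ apply)) →
               Σ (BallIso k a b c d) λ i → S (apply i) × Extendable k (apply i)
      select k S hyp = proj₁ (limit 0) , proj₁ (proj₂ (limit 0)) , extendable
        where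
          L M : List V
          L = ballEList k a b
          M = ballEList k c d
          Restricts : ℕ → List V → Set
          Restricts m ys = Σ (BallIso (m + k) a b c d) λ j → S (apply j) × map (apply j) L ≡ ys
          restricts-antitone : ∀ {m m' ys} → m ≤ m' → Restricts m' ys → Restricts m ys
          restricts-antitone le (j , s , e) = restrict (+-monoˡ-≤ k le) j , s , e
          candidates : ∀ m → Any (Restricts m) (words (length L) M)
          candidates m = let (i , s) = hyp (m + k) in
            lose (map-∈-words L (∈-ballEList⁺ ∘ restrict-BallE (m≤n+m k m) i ∘ ∈-ballEList⁻)) (i , s , refl)
          recurring : ∃[ ys ] ∀ m → Restricts m ys
          recurring = satisfied (pigeonhole lem restricts-antitone _ candidates)
          limit : ∀ m → Restricts m (proj₁ recurring)
          limit = proj₂ recurring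
          extendable : Extendable k (apply (proj₁ (limit 0)))
          extendable m = restrict (m≤m+n m k) (proj₁ (limit m)) ,
                         λ v p → map-≡⇒≡ (trans (proj₂ (proj₂ (limit 0))) (sym (proj₂ (proj₂ (limit m)))))
                                         (∈-ballEList⁺ p)

      Stage : ℕ → Set
      Stage n = Σ (BallIso n a b c d) (Extendable n ∘ apply)

      next : (s : Stage n) → Σ (BallIso (suc n) a b c d) λ i →
             AgreeOn (BallE G n a b) (apply (proj₁ s)) (apply i) × Extendable (suc n) (apply i)
      next {n} (i , extendable) = select (suc n) (AgreeOn (BallE G n a b) (apply i)) extendable

      stages : φE-≡ G a b c d → ∀ n → Stage n
      stages φ zero = let (i , _ , extendable) = select 0 (λ _ → ⊤) (λ m → φ m , tt) in i , extendable
      stages φ (suc n) = let (i , _ , extendable) = next (stages φ n) in i , extendable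

      φE-≡⇒Coherent : φE-≡ G a b c d → Coherent a b c d
      φE-≡⇒Coherent φ = record
        { level = proj₁ ∘ stages φ
        ; coherent = λ n → proj₁ (proj₂ (next (stages φ n))) }

    module _ (lf : LocallyFinite G) where

      φE-≡⇔Automorphism : Connected G a b → Connected G b c → Connected G c d →
                          φE-≡ G a b c d ⇔ Σ (Automorphism G) (λ α → MapsEdge G (Automorphism.σ α) a b c d)
      φE-≡⇔Automorphism ab bc cd =
        mk⇔ (Coherent⇒Automorphism ab bc cd ∘ φE-≡⇒Coherent lf) Automorphism⇒φE-≡

      φV-≡⇔Automorphism : Connected G x y → φV-≡ G x y ⇔ Σ (Automorphism G) (λ α → Automorphism.σ α x ≡ y)
      φV-≡⇔Automorphism {x} {y} xy =
        ⇔.trans φV-≡⇔φE-≡ (⇔.trans (φE-≡⇔Automorphism Connected-refl xy Connected-refl) diagonal)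
        where
          diagonal : Σ (Automorphism G) (λ α → MapsEdge G (Automorphism.σ α) x x y y) ⇔
                     Σ (Automorphism G) (λ α → Automorphism.σ α x ≡ y)
          diagonal = mk⇔ (λ (α , me) → α , to (MapsEdge-diagonal (Automorphism.σ α)) me)
                         (λ (α , α[x]≡y) → α , from (MapsEdge-diagonal (Automorphism.σ α)) α[x]≡y)

lemma3p2 : ExcludedMiddle 0ℓ → (G : Graph) → LocallyFinite G →
    ((x y : Graph.V G) → Graph._~_ G x y →
      φV-≡ G x y ⇔ Σ (Automorphism G) (λ α → Automorphism.σ α x ≡ y))
    × ((a b c d : Graph.V G) → Graph._~_ G a b → Graph._~_ G c d → Connected G b c →
      φE-≡ G a b c d ⇔ Σ (Automorphism G) (λ α → MapsEdge G (Automorphism.σ α) a b c d))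
lemma3p2 lem G lf =
  (λ x y x~y → φV-≡⇔Automorphism G lem lf (~⇒Connected G x~y)) ,
  (λ a b c d a~b c~d b↝c → φE-≡⇔Automorphism G lem lf (~⇒Connected G a~b) b↝c (~⇒Connected G c~d))
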